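{- Let $a$ be an element of an $\omega$-complete effect monoid $M$. (1) The floor $\lfloor a\rfloor$ is an idempotent with $\lfloor a\rfloor\le a$; in fact it is the greatest idempotent below $a$. (2) The ceiling $\lceil a\rceil$ is the least idempotent above $a$. (3) $\lceil a\rceil^\perp=\lfloor a^\perp\rfloor$ and $\lfloor a\rfloor^\perp=\lceil a^\perp\rceil$.
   Context: An effect algebra is a set $E$ with an element $0$, a partial binary operation $a+b$ (the partial sum), and a total complement $a\mapsto a^\perp$, such that: the sum is commutative and associative wherever defined, $a+0=a$, $a^\perp$ is the unique element with $a+a^\perp=1$ where $1:=0^\perp$, and $a+1$ defined implies $a=0$. The order is $a\le b$ iff $b=a+c$ for some $c$. An effect monoid is an effect algebra with an associative total multiplication $\cdot$ with unit $1$ which distributes over the partial sum on both sides. It is $\omega$-complete if every increasing sequence has a supremum. An element $p$ is idempotent if $p\cdot p=p$. The infinite sum $\sum_n x_n$ is the supremum of the finite partial sums (when these are all defined and the supremum exists). The ceiling is $\lceil a\rceil=\sum_{n=0}^\infty a\cdot(a^\perp)^n$ and the floor is $\lfloor a\rfloor=\bigwedge_{n=0}^\infty a^n$; both exist in an $\omega$-complete effect monoid. -}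

module Defs where

open import Level using (Level; suc; _⊔_)
open import Data.Nat using (ℕ; zero) renaming (suc to sucℕ)
open import Data.Product using (Σ; ∃; _×_; _,_)
open import Relation.Binary.PropositionalEquality using (_≡_)

-- An effect algebra. The partial sum is encoded as a ternary relation
-- 'Sum a b c', read "a + b is defined and equals c".
record EffectAlgebra (c : Level) : Set (suc c) where
  field
    Carrier : Set c
    Sum     : Carrier → Carrier → Carrier → Set c
    𝟘       : Carrier
    _ᗮ      : Carrier → Carrier

  𝟙 : Carrier
  𝟙 = 𝟘 ᗮ

  field
    Sum-functional : ∀ {a b c d} → Sum a b c → Sum a b d → c ≡ d
    Sum-comm       : ∀ {a b c} → Sum a b c → Sum b a c
    Sum-assoc      : ∀ {a b c d e} → Sum a b d → Sum d c e →
                     Σ Carrier (λ f → Sum b c f × Sum a f e)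
    Sum-zero       : ∀ a → Sum a 𝟘 a
    Sum-compl      : ∀ a → Sum a (a ᗮ) 𝟙
    compl-unique   : ∀ {a b} → Sum a b 𝟙 → b ≡ a ᗮ
    zero-one       : ∀ {a c} → Sum a 𝟙 c → a ≡ 𝟘

  _≤_ : Carrier → Carrier → Set c
  a ≤ b = Σ Carrier (λ c → Sum a c b)

  infix 4 _≤_

  IsLUB : (Carrier → Set c) → Carrier → Set c
  IsLUB P s = (∀ x → P x → x ≤ s) × (∀ u → (∀ x → P x → x ≤ u) → s ≤ u)

  IsGLB : (Carrier → Set c) → Carrier → Set c
  IsGLB P s = (∀ x → P x → s ≤ x) × (∀ u → (∀ x → P x → u ≤ x) → u ≤ s)

  Range : (ℕ → Carrier) → Carrier → Set c
  Range x e = Σ ℕ (λ n → x n ≡ e)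

  data PartialSum (x : ℕ → Carrier) : ℕ → Carrier → Set c where
    ps-zero : PartialSum x zero 𝟘
    ps-suc  : ∀ {n s t} → PartialSum x n s → Sum s (x n) t → PartialSum x (sucℕ n) t

  HasSum : (ℕ → Carrier) → Carrier → Set c
  HasSum x s = (∀ n → Σ Carrier (λ t → PartialSum x n t))
             × IsLUB (λ e → Σ ℕ (λ n → PartialSum x n e)) s

  Increasing : (ℕ → Carrier) → Set c
  Increasing x = ∀ n → x n ≤ x (sucℕ n)

record EffectMonoid (c : Level) : Set (suc c) where
  field
    effectAlgebra : EffectAlgebra c

  open EffectAlgebra effectAlgebra public

  field
    _·_       : Carrier → Carrier → Carrier
    ·-assoc   : ∀ a b d → (a · b) · d ≡ a · (b · d)
    ·-identityˡ : ∀ a → 𝟙 · a ≡ a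
    ·-identityʳ : ∀ a → a · 𝟙 ≡ a
    ·-distribˡ : ∀ x {a b d} → Sum a b d → Sum (x · a) (x · b) (x · d)
    ·-distribʳ : ∀ x {a b d} → Sum a b d → Sum (a · x) (b · x) (d · x)

  infixl 7 _·_

  _^_ : Carrier → ℕ → Carrier
  a ^ zero = 𝟙
  a ^ sucℕ n = a · (a ^ n)

  IsIdempotent : Carrier → Set c
  IsIdempotent p = p · p ≡ p

  IsOmegaComplete : Set c
  IsOmegaComplete = ∀ (x : ℕ → Carrier) → Increasing x → Σ Carrier (IsLUB (Range x))

  IsFloor : Carrier → Carrier → Set c
  IsFloor a f = IsGLB (Range (λ n → a ^ n)) f

  IsCeiling : Carrier → Carrier → Set c
  IsCeiling a d = HasSum (λ n → a · ((a ᗮ) ^ n)) d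

module Submission where

-- The argument rests on three general facts.
--  * In any effect algebra the complement is an order-reversing involution,
--    so it exchanges suprema and infima of sequences; hence ω-completeness
--    also provides infima of decreasing sequences.
--  * An additive map φ with φ(x) ≤ x commutes with infima of sequences
--    (a continuity property); multiplication by a fixed element is such a map.
--  * The n-th partial sum of the ceiling series Σₖ a·(aᗮ)ᵏ telescopes to
--    ((aᗮ)ⁿ)ᗮ, so ⌈a⌉ exists and ⌈a⌉ᗮ = ⋀ₙ (aᗮ)ⁿ = ⌊aᗮ⌋.
-- Continuity makes ⌊a⌋ = ⋀ₙ aⁿ idempotent: ⌊a⌋·aⁿ = ⋀ₘ aᵐ⁺ⁿ ≥ ⌊a⌋ and then
-- ⌊a⌋·⌊a⌋ = ⋀ₙ ⌊a⌋·aⁿ ≥ ⌊a⌋; maximality among idempotents below a is direct.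
-- All claims about the ceiling then follow from those about ⌊aᗮ⌋ by taking
-- complements, since the complement of an idempotent is idempotent.

open import Defs
open import Data.Nat using (ℕ; zero; _+_) renaming (suc to sucℕ)
open import Data.Product using (Σ; _×_; _,_; proj₁; proj₂)
open import Function.Base using (_∘_)
open import Relation.Binary.PropositionalEquality using (_≡_; refl; sym; trans; cong; subst; subst₂)

module EffectAlgebraFacts {ℓ} (E : EffectAlgebra ℓ) where
  open EffectAlgebra E

  Sum-assocˡ : ∀ {a b c f e} → Sum b c f → Sum a f e →
               Σ Carrier (λ d → Sum a b d × Sum d c e)
  Sum-assocˡ b+c a+f with Sum-assoc (Sum-comm b+c) (Sum-comm a+f)
  ... | d , b+a , c+d = d , Sum-comm b+a , Sum-comm c+d

  ᗮ-involutive : ∀ a → a ᗮ ᗮ ≡ a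
  ᗮ-involutive a = sym (compl-unique (Sum-comm (Sum-compl a)))

  𝟙ᗮ≡𝟘 : 𝟙 ᗮ ≡ 𝟘
  𝟙ᗮ≡𝟘 = ᗮ-involutive 𝟘

  -- If a + b = c then b + cᗮ = aᗮ, because a + (b + cᗮ) = 1.
  Sum-shift : ∀ {a b c} → Sum a b c → Sum b (c ᗮ) (a ᗮ)
  Sum-shift a+b with Sum-assoc a+b (Sum-compl _)
  ... | g , b+cᗮ , a+g with compl-unique a+g
  ... | refl = b+cᗮ

  difference : ∀ {a b c} → Sum a b c → Σ Carrier (λ h → Sum (c ᗮ) a h × b ≡ h ᗮ)
  difference a+b with Sum-assoc (Sum-shift a+b) (Sum-comm (Sum-compl _))
  ... | h , cᗮ+a , b+h = h , cᗮ+a , compl-unique (Sum-comm b+h)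

  cancel : ∀ {a b b' c} → Sum a b c → Sum a b' c → b ≡ b'
  cancel a+b a+b' with difference a+b | difference a+b'
  ... | h , h-sum , b≡hᗮ | h' , h'-sum , b'≡h'ᗮ =
    trans b≡hᗮ (trans (cong _ᗮ (Sum-functional h-sum h'-sum)) (sym b'≡h'ᗮ))

  Sum-zeroˡ : ∀ {b c} → Sum 𝟘 b c → b ≡ c
  Sum-zeroˡ 0+b = Sum-functional (Sum-zero _) (Sum-comm 0+b)

  -- Positivity: a + b = 0 forces a = 0, since then a + 1 is defined.
  positive : ∀ {a b} → Sum a b 𝟘 → a ≡ 𝟘
  positive a+b with Sum-assoc (Sum-comm a+b) (Sum-comm (Sum-zero 𝟙))
  ... | _ , a+1 , _ = zero-one a+1

  ≤-trans : ∀ {a b e} → a ≤ b → b ≤ e → a ≤ e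
  ≤-trans (c , a+c) (d , b+d) with Sum-assoc a+c b+d
  ... | f , _ , a+f = f , a+f

  ≤-antisym : ∀ {a b} → a ≤ b → b ≤ a → a ≡ b
  ≤-antisym {a} (c , a+c) (d , b+d) with Sum-assoc a+c b+d
  ... | g , c+d , a+g with cancel a+g (Sum-zero a)
  ... | refl with positive c+d
  ... | refl = Sum-functional (Sum-zero a) a+c

  ≤-𝟙 : ∀ a → a ≤ 𝟙
  ≤-𝟙 a = a ᗮ , Sum-compl a

  ᗮ-antitone : ∀ {a b} → a ≤ b → b ᗮ ≤ a ᗮ
  ᗮ-antitone (c , a+c) = c , Sum-comm (Sum-shift a+c)

  ᗮ-swapˡ : ∀ {a b} → a ᗮ ≤ b → b ᗮ ≤ a
  ᗮ-swapˡ {a} aᗮ≤b = subst (_ ≤_) (ᗮ-involutive a) (ᗮ-antitone aᗮ≤b)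

  ᗮ-swapʳ : ∀ {a b} → a ≤ b ᗮ → b ≤ a ᗮ
  ᗮ-swapʳ {b = b} a≤bᗮ = subst (_≤ _) (ᗮ-involutive b) (ᗮ-antitone a≤bᗮ)

  ᗮ-reflect : ∀ {a b} → a ᗮ ≤ b ᗮ → b ≤ a
  ᗮ-reflect {b = b} aᗮ≤bᗮ = subst (_≤ _) (ᗮ-involutive b) (ᗮ-swapˡ aᗮ≤bᗮ)

  cancel-≤ : ∀ {a b c s t} → Sum a b s → Sum a c t → s ≤ t → b ≤ c
  cancel-≤ a+b a+c (k , s+k) with Sum-assoc a+b s+k
  ... | g , b+k , a+g with cancel a+g a+c
  ... | refl = k , b+k

  +-monoʳ-≤ : ∀ {a b c t} → b ≤ c → Sum a c t → Σ Carrier (λ s → Sum a b s × s ≤ t)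
  +-monoʳ-≤ (k , b+k) a+c with Sum-assocˡ b+k a+c
  ... | s , a+b , s+k = s , a+b , (k , s+k)

  absorb : ∀ {y w s} → Sum y w s → s ≤ y → w ≡ 𝟘
  absorb {y} y+w (k , s+k) with Sum-assoc y+w s+k
  ... | g , w+k , y+g with cancel y+g (Sum-zero y)
  ... | refl = positive w+k

  IsInf : (ℕ → Carrier) → Carrier → Set ℓ
  IsInf y = IsGLB (Range y)

  IsSup : (ℕ → Carrier) → Carrier → Set ℓ
  IsSup x = IsLUB (Range x)

  inf-lower : ∀ {y g} → IsInf y g → ∀ n → g ≤ y n
  inf-lower (lower , _) n = lower _ (n , refl)

  inf-greatest : ∀ {y g} → IsInf y g → ∀ u → (∀ n → u ≤ y n) → u ≤ g
  inf-greatest (_ , greatest) u u-lower = greatest u (λ { _ (n , refl) → u-lower n })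

  mk-inf : ∀ {y g} → (∀ n → g ≤ y n) → (∀ u → (∀ n → u ≤ y n) → u ≤ g) → IsInf y g
  mk-inf lower greatest =
    (λ { _ (n , refl) → lower n }) , (λ u u-lower → greatest u (λ n → u-lower _ (n , refl)))

  sup-upper : ∀ {x s} → IsSup x s → ∀ n → x n ≤ s
  sup-upper (upper , _) n = upper _ (n , refl)

  sup-least : ∀ {x s} → IsSup x s → ∀ u → (∀ n → x n ≤ u) → s ≤ u
  sup-least (_ , least) u u-upper = least u (λ { _ (n , refl) → u-upper n })

  mk-sup : ∀ {x s} → (∀ n → x n ≤ s) → (∀ u → (∀ n → x n ≤ u) → s ≤ u) → IsSup x s
  mk-sup upper least =
    (λ { _ (n , refl) → upper n }) , (λ u u-upper → least u (λ n → u-upper _ (n , refl)))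

  inf-unique : ∀ {y g g'} → IsInf y g → IsInf y g' → g ≡ g'
  inf-unique inf inf' =
    ≤-antisym (inf-greatest inf' _ (inf-lower inf)) (inf-greatest inf _ (inf-lower inf'))

  sup-compl : ∀ {y s} → IsSup (λ n → y n ᗮ) s → IsInf y (s ᗮ)
  sup-compl sup = mk-inf (λ n → ᗮ-swapˡ (sup-upper sup n))
                         (λ u u-lower → ᗮ-swapʳ (sup-least sup (u ᗮ) (ᗮ-antitone ∘ u-lower)))

  inf-compl : ∀ {y g} → IsInf y g → IsSup (λ n → y n ᗮ) (g ᗮ)
  inf-compl inf = mk-sup (ᗮ-antitone ∘ inf-lower inf)
                         (λ u u-upper → ᗮ-swapˡ (inf-greatest inf (u ᗮ) (ᗮ-swapˡ ∘ u-upper)))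

  -- ω-completeness at the generality of effect algebras; it is definitionally
  -- the monoid's IsOmegaComplete.
  OmegaComplete : Set ℓ
  OmegaComplete = ∀ x → Increasing x → Σ Carrier (IsSup x)

  Decreasing : (ℕ → Carrier) → Set ℓ
  Decreasing y = ∀ n → y (sucℕ n) ≤ y n

  -- A decreasing sequence has an infimum: the complement of ⋁ₙ (y n)ᗮ.
  inf-exists : OmegaComplete → ∀ y → Decreasing y → Σ Carrier (IsInf y)
  inf-exists ω y decreasing with ω (λ n → y n ᗮ) (ᗮ-antitone ∘ decreasing)
  ... | s , sup = s ᗮ , sup-compl sup

  Additive : (Carrier → Carrier) → Set ℓ
  Additive φ = ∀ {a b d} → Sum a b d → Sum (φ a) (φ b) (φ d)

  Deflationary : (Carrier → Carrier) → Set ℓ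
  Deflationary φ = ∀ d → φ d ≤ d

  additive-monotone : ∀ {φ} → Additive φ → ∀ {a b} → a ≤ b → φ a ≤ φ b
  additive-monotone additive (c , a+c) = _ , additive a+c

  -- Writing φ(m) + w = ⋀ φ(yₙ) and yₙ = m + dₙ, additivity gives w ≤ φ(dₙ) ≤ dₙ,
  -- so m + w is a lower bound of y, whence m + w ≤ m and w = 0.
  inf-commutes : ∀ {φ} → Additive φ → Deflationary φ →
                 ∀ {y m g} → IsInf y m → IsInf (φ ∘ y) g → g ≡ φ m
  inf-commutes {φ} additive deflationary {y} {m} {g} inf-y inf-φy =
    Sum-functional (subst (λ z → Sum (φ m) z g) w≡𝟘 φm+w) (Sum-zero (φ m))
    where
    φm≤g : φ m ≤ g
    φm≤g = inf-greatest inf-φy (φ m) (additive-monotone additive ∘ inf-lower inf-y)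

    w : Carrier
    w = proj₁ φm≤g

    φm+w : Sum (φ m) w g
    φm+w = proj₂ φm≤g

    w-below-defect : ∀ n → Σ Carrier (λ d → Sum m d (y n) × w ≤ d)
    w-below-defect n =
      let (d , m+d) = inf-lower inf-y n
      in d , m+d , ≤-trans (cancel-≤ φm+w (additive m+d) (inf-lower inf-φy n)) (deflationary d)

    m+w : Σ Carrier (Sum m w)
    m+w = let (d , m+d , w≤d) = w-below-defect 0
              (s , m+w-sum , _) = +-monoʳ-≤ w≤d m+d
          in s , m+w-sum

    m+w-lower : ∀ n → proj₁ m+w ≤ y n
    m+w-lower n =
      let (d , m+d , w≤d) = w-below-defect n
          (s , m+w-sum , s≤yn) = +-monoʳ-≤ w≤d m+d
      in subst (_≤ y n) (Sum-functional m+w-sum (proj₂ m+w)) s≤yn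

    w≡𝟘 : w ≡ 𝟘
    w≡𝟘 = absorb (proj₂ m+w) (inf-greatest inf-y _ m+w-lower)

  inf-preserved : OmegaComplete → ∀ {φ} → Additive φ → Deflationary φ →
                  ∀ {y m} → Decreasing y → IsInf y m → IsInf (φ ∘ y) (φ m)
  inf-preserved ω {φ} additive deflationary {y} decreasing inf-y
    with inf-exists ω (φ ∘ y) (additive-monotone additive ∘ decreasing)
  ... | g , inf-g = subst (IsInf (φ ∘ y)) (inf-commutes additive deflationary inf-y inf-g) inf-g

  partialSum-unique : ∀ {x n t t'} → PartialSum x n t → PartialSum x n t' → t ≡ t'
  partialSum-unique ps-zero ps-zero = refl
  partialSum-unique (ps-suc p s) (ps-suc p' s') with partialSum-unique p p'
  ... | refl = Sum-functional s s'

  hasSum⇒sup : ∀ {x S d} → (∀ n → PartialSum x n (S n)) → HasSum x d → IsSup S d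
  hasSum⇒sup sums (_ , upper , least) =
    mk-sup (λ n → upper _ (n , sums n))
           (λ u u-upper → least u (λ { _ (n , p) →
              subst (_≤ u) (partialSum-unique (sums n) p) (u-upper n) }))

  sup⇒hasSum : ∀ {x S d} → (∀ n → PartialSum x n (S n)) → IsSup S d → HasSum x d
  sup⇒hasSum sums sup =
    (λ n → _ , sums n) ,
    (λ { _ (n , p) → subst (_≤ _) (partialSum-unique (sums n) p) (sup-upper sup n) }) ,
    (λ u u-upper → sup-least sup u (λ n → u-upper _ (n , sums n)))

module EffectMonoidFacts {ℓ} (M : EffectMonoid ℓ) where
  open EffectMonoid M
  open EffectAlgebraFacts effectAlgebra

  ·-deflationaryˡ : ∀ x → Deflationary (x ·_)
  ·-deflationaryˡ x d = subst (x · d ≤_) (·-identityˡ d) (additive-monotone (·-distribʳ d) (≤-𝟙 x))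

  ·-deflationaryʳ : ∀ x → Deflationary (_· x)
  ·-deflationaryʳ x d = subst (d · x ≤_) (·-identityʳ d) (additive-monotone (·-distribˡ d) (≤-𝟙 x))

  ^-+ : ∀ a m n → (a ^ m) · (a ^ n) ≡ a ^ (m + n)
  ^-+ a zero n = ·-identityˡ (a ^ n)
  ^-+ a (sucℕ m) n = trans (·-assoc a (a ^ m) (a ^ n)) (cong (a ·_) (^-+ a m n))

  powers-decreasing : ∀ a → Decreasing (a ^_)
  powers-decreasing a n = ·-deflationaryˡ a (a ^ n)

  -- If p is idempotent then so is pᗮ: pᗮ·p = 0 because p·p + pᗮ·p = p,
  -- and then pᗮ = pᗮ·p + pᗮ·pᗮ = pᗮ·pᗮ.
  ᗮ-idempotent : ∀ {p} → IsIdempotent p → IsIdempotent (p ᗮ)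
  ᗮ-idempotent {p} idem = Sum-zeroˡ (subst (λ z → Sum z (p ᗮ · p ᗮ) (p ᗮ)) pᗮp≡𝟘 pᗮ·split)
    where
    pᗮp≡𝟘 : p ᗮ · p ≡ 𝟘
    pᗮp≡𝟘 = cancel (subst₂ (λ u v → Sum u (p ᗮ · p) v) idem (·-identityˡ p)
                      (·-distribʳ p (Sum-compl p)))
                   (Sum-zero p)

    pᗮ·split : Sum (p ᗮ · p) (p ᗮ · p ᗮ) (p ᗮ)
    pᗮ·split = subst (Sum _ _) (·-identityʳ (p ᗮ)) (·-distribˡ (p ᗮ) (Sum-compl p))

  -- The partial sums of the ceiling series telescope: from
  -- a·(aᗮ)ⁿ + (aᗮ)ⁿ⁺¹ = (aᗮ)ⁿ we get ((aᗮ)ⁿ)ᗮ + a·(aᗮ)ⁿ = ((aᗮ)ⁿ⁺¹)ᗮ.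
  ceiling-step : ∀ a n → Sum (((a ᗮ) ^ n) ᗮ) (a · ((a ᗮ) ^ n)) (((a ᗮ) ^ sucℕ n) ᗮ)
  ceiling-step a n = Sum-comm (Sum-shift (Sum-comm split))
    where
    split : Sum (a · ((a ᗮ) ^ n)) ((a ᗮ) ^ sucℕ n) ((a ᗮ) ^ n)
    split = subst (Sum _ _) (·-identityˡ _) (·-distribʳ ((a ᗮ) ^ n) (Sum-compl a))

  ceiling-partialSum : ∀ a n → PartialSum (λ k → a · ((a ᗮ) ^ k)) n (((a ᗮ) ^ n) ᗮ)
  ceiling-partialSum a zero = subst (PartialSum _ zero) (sym 𝟙ᗮ≡𝟘) ps-zero
  ceiling-partialSum a (sucℕ n) = ps-suc (ceiling-partialSum a n) (ceiling-step a n)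

  ceiling⇒floor : ∀ {a d} → IsCeiling a d → IsFloor (a ᗮ) (d ᗮ)
  ceiling⇒floor {a} ceil = sup-compl (hasSum⇒sup (ceiling-partialSum a) ceil)

  floor⇒ceiling : ∀ {a f} → IsFloor (a ᗮ) f → IsCeiling a (f ᗮ)
  floor⇒ceiling {a} floor = sup⇒hasSum (ceiling-partialSum a) (inf-compl floor)

  ceiling-compl : ∀ {a d f} → IsCeiling a d → IsFloor (a ᗮ) f → d ᗮ ≡ f
  ceiling-compl ceil floor = inf-unique (ceiling⇒floor ceil) floor

  floor-compl : ∀ {a f d} → IsFloor a f → IsCeiling (a ᗮ) d → f ᗮ ≡ d
  floor-compl {a} {f} {d} floor ceil =
    trans (cong _ᗮ (inf-unique floor floor-a)) (ᗮ-involutive d)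
    where
    floor-a : IsFloor a (d ᗮ)
    floor-a = subst (λ b → IsFloor b (d ᗮ)) (ᗮ-involutive a) (ceiling⇒floor ceil)

  -- A floor lies below a = a¹, and is above every idempotent below a,
  -- since such a p satisfies p = pⁿ ≤ aⁿ.
  floor-below : ∀ {a f} → IsFloor a f → f ≤ a
  floor-below {a} floor = subst (_ ≤_) (·-identityʳ a) (inf-lower floor 1)

  floor-greatest : ∀ {a f} → IsFloor a f → ∀ {p} → IsIdempotent p → p ≤ a → p ≤ f
  floor-greatest {a} floor {p} idem p≤a = inf-greatest floor p p≤powers
    where
    p≤powers : ∀ n → p ≤ a ^ n
    p≤powers zero = ≤-𝟙 p
    p≤powers (sucℕ n) =
      subst (_≤ a ^ sucℕ n) idem
        (≤-trans (additive-monotone (·-distribʳ p) p≤a) (additive-monotone (·-distribˡ a) (p≤powers n)))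

  module OmegaCompleteFacts (ω : IsOmegaComplete) where

    floor-exists : ∀ a → Σ Carrier (IsFloor a)
    floor-exists a = inf-exists ω (a ^_) (powers-decreasing a)

    ceiling-exists : ∀ a → Σ Carrier (IsCeiling a)
    ceiling-exists a = let (f , floor) = floor-exists (a ᗮ) in f ᗮ , floor⇒ceiling floor

    -- By continuity f·aⁿ = ⋀ₘ aᵐ⁺ⁿ ≥ f, and then f·f = ⋀ₙ f·aⁿ ≥ f.
    floor-idempotent : ∀ {a f} → IsFloor a f → IsIdempotent f
    floor-idempotent {a} {f} floor = ≤-antisym (·-deflationaryˡ f f) f≤ff
      where
      f≤f·aⁿ : ∀ n → f ≤ f · (a ^ n)
      f≤f·aⁿ n =
        inf-greatest (inf-preserved ω (·-distribʳ (a ^ n)) (·-deflationaryʳ (a ^ n))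
                                    (powers-decreasing a) floor)
                     f (λ m → subst (f ≤_) (sym (^-+ a m n)) (inf-lower floor (m + n)))

      f≤ff : f ≤ f · f
      f≤ff = inf-greatest (inf-preserved ω (·-distribˡ f) (·-deflationaryˡ f)
                                         (powers-decreasing a) floor)
                          f f≤f·aⁿ

    -- The ceiling properties are the floor properties of aᗮ, complemented.
    ceiling-idempotent : ∀ {a d} → IsCeiling a d → IsIdempotent d
    ceiling-idempotent {d = d} ceil =
      subst IsIdempotent (ᗮ-involutive d) (ᗮ-idempotent (floor-idempotent (ceiling⇒floor ceil)))

    ceiling-above : ∀ {a d} → IsCeiling a d → a ≤ d
    ceiling-above ceil = ᗮ-reflect (floor-below (ceiling⇒floor ceil))

    ceiling-least : ∀ {a d} → IsCeiling a d → ∀ {p} → IsIdempotent p → a ≤ p → d ≤ p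
    ceiling-least ceil idem a≤p =
      ᗮ-reflect (floor-greatest (ceiling⇒floor ceil) (ᗮ-idempotent idem) (ᗮ-antitone a≤p))

proposition35 : ∀ {ℓ} (M : EffectMonoid ℓ) → EffectMonoid.IsOmegaComplete M →
    let open EffectMonoid M in
    ∀ (a : Carrier) →
    ( Σ Carrier (IsFloor a)
    × (∀ f → IsFloor a f →
    IsIdempotent f × f ≤ a × (∀ p → IsIdempotent p → p ≤ a → p ≤ f)) )
    × ( Σ Carrier (IsCeiling a)
    × (∀ d → IsCeiling a d →
    IsIdempotent d × a ≤ d × (∀ p → IsIdempotent p → a ≤ p → d ≤ p)) )
    × (∀ d f → IsCeiling a d → IsFloor (a ᗮ) f → d ᗮ ≡ f)
    × (∀ f d → IsFloor a f → IsCeiling (a ᗮ) d → f ᗮ ≡ d)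
proposition35 M ω a =
    ( floor-exists a
    , λ f floor → floor-idempotent floor , floor-below floor , λ p → floor-greatest floor )
  , ( ceiling-exists a
    , λ d ceil → ceiling-idempotent ceil , ceiling-above ceil , λ p → ceiling-least ceil )
  , (λ d f → ceiling-compl)
  , (λ f d → floor-compl)
  where
  open EffectMonoidFacts M
  open OmegaCompleteFacts ω
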